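{- Let $(a_p)_p$ and $(b_p)_p$ be sequences of integers indexed by primes such that $a_p\to\infty$, $b_p\to\infty$, and, for every positive integer $d$, $a_p^d=o(p)$ and $b_p^d=o(a_p)$ as $p\to\infty$. Then $(a_p\bmod p)_p$ and $(b_p\bmod p)_p$ are algebraically independent over $\mathbb{Q}$.
   Context: $\mathcal{A}\coloneqq\bigl(\prod_{p}\mathbb{Z}/p\mathbb{Z}\bigr)/\bigl(\bigoplus_{p}\mathbb{Z}/p\mathbb{Z}\bigr)$ over all primes $p$; elements are written $(a_p)_p$, equal iff components agree for all but finitely many primes. Elements $\alpha,\beta\in\mathcal{A}$ are algebraically independent over $\mathbb{Q}$ if $F(\alpha,\beta)\neq0$ in $\mathcal{A}$ for every nonzero $F(x,y)\in\mathbb{Z}[x,y]$. -}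

module Defs where

open import Data.Nat as ℕ using (ℕ)
open import Data.Nat.Primality using (Prime)
open import Data.Integer as ℤ using (ℤ; +_; _+_; _*_; _-_)
open import Data.Integer.Divisibility using (_∣_)
open import Data.List using (List; []; _∷_)
open import Data.List.Relation.Unary.Any using (Any)
open import Data.Product using (∃)
open import Relation.Binary.PropositionalEquality using (_≢_)
open import Relation.Nullary using (¬_)

EventuallyPrimes : (ℕ → Set) → Set
EventuallyPrimes P = ∃ λ N → ∀ p → Prime p → N ℕ.≤ p → P p

-- The ring 𝒜 = (∏_p ℤ/pℤ) / (⊕_p ℤ/pℤ), as a setoid.
-- An element of ∏_p ℤ/pℤ is represented by a function x : ℕ → ℤ,
-- where x p is read modulo p (values at non-primes are irrelevant).

Seq : Set
Seq = ℕ → ℤ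

_≈𝒜_ : Seq → Seq → Set
x ≈𝒜 y = EventuallyPrimes (λ p → (+ p) ∣ (x p - y p))

0𝒜 : Seq
0𝒜 _ = + 0

-- Polynomials in ℤ[x,y]: F = Σ_i Σ_j c i j x^i y^j represented as a list
-- (indexed by i) of lists (indexed by j) of integer coefficients.

Poly1 : Set
Poly1 = List ℤ

Poly2 : Set
Poly2 = List Poly1

eval1 : Poly1 → ℤ → ℤ
eval1 []       y = + 0
eval1 (c ∷ cs) y = c + y * eval1 cs y

eval2 : Poly2 → ℤ → ℤ → ℤ
eval2 []       x y = + 0
eval2 (q ∷ qs) x y = eval1 q y + x * eval2 qs x y

NonZeroPoly : Poly2 → Set
NonZeroPoly F = Any (Any (λ c → c ≢ + 0)) F

-- Componentwise evaluation F(α,β) in ∏_p ℤ/pℤ (ring operations commute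
-- with reduction mod p), hence in 𝒜.
eval𝒜 : Poly2 → Seq → Seq → Seq
eval𝒜 F α β p = eval2 F (α p) (β p)

AlgIndep : Seq → Seq → Set
AlgIndep α β = ∀ F → NonZeroPoly F → ¬ (eval𝒜 F α β ≈𝒜 0𝒜)

TendsToInfinity : Seq → Set
TendsToInfinity a = ∀ (M : ℕ) → EventuallyPrimes (λ p → + M ℤ.≤ a p)

-- f(p) = o(g(p)) for natural-valued f, g: for every ε = 1/(k+1) > 0,
-- eventually f(p) ≤ ε g(p), i.e. (k+1) f(p) ≤ g(p).
LittleO : (ℕ → ℕ) → (ℕ → ℕ) → Set
LittleO f g = ∀ (k : ℕ) → EventuallyPrimes (λ p → ℕ.suc k ℕ.* f p ℕ.≤ g p)

{-# OPTIONS --safe #-}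
-- The hypotheses make b_p tiny compared with a_p and every power of a_p tiny
-- compared with p. So for large p the coefficients of F are "digits" smaller
-- than |b_p|, the values F_i(b_p) of the rows of F = Σ x^i F_i(y) are digits
-- smaller than |a_p|, and F(a_p, b_p) is a number written in base a_p with
-- digits F_i(b_p), themselves written in base b_p. A nonzero digit string
-- gives a nonzero number, so 0 < |F(a_p, b_p)| < |a_p|^(deg_x F + 1) ≤ p and
-- p ∤ F(a_p, b_p) for all large primes p; as there are infinitely many
-- primes, F(a, b) ≠ 0 in 𝒜.
module Submission where

open import Defs
open import Data.Nat as ℕ using (ℕ; suc; z≤n; s≤s; _≤_; _<_; _≰_; _≥_; _^_; _!; NonZero)
open import Data.Nat.Properties as ℕ using (≤-trans; <-≤-trans; *-monoʳ-≤; *-cancelˡ-<)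
open import Data.Nat.Divisibility as ℕ using (m∣m*n; ∣-trans; m≤n⇒m!∣n!; ∣m+n∣m⇒∣n; ∣1⇒≡1; >⇒∤)
open import Data.Nat.Primality using (Prime; ¬prime[1]; prime⇒nonZero)
open import Data.Nat.Primality.Factorisation using (factorise)
open import Data.Integer as ℤ using (+_; _+_; _*_; -_; ∣_∣)
open import Data.Integer.Divisibility using (_∣_)
open import Data.Integer.Properties
  using (∣i+j∣≤∣i∣+∣j∣; abs-*; ∣-i∣≡∣i∣; ∣i∣≡0⇒i≡0; i-j≡0⇒i≡j; neg-involutive; *-zeroʳ; +-identityʳ)
open import Data.List using (List; []; _∷_; length)
open import Data.List.Relation.Unary.All using (All; []; _∷_; lookupAny)
open import Data.Product using (∃; _,_; _×_)
open import Relation.Binary.PropositionalEquality using (_≡_; _≢_; sym; trans; cong; subst; subst₂)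
open import Relation.Nullary using (¬_)
open import Data.Empty using (⊥-elim)

eventually-∧ : ∀ {P Q : ℕ → Set} → EventuallyPrimes P → EventuallyPrimes Q
  → EventuallyPrimes (λ p → P p × Q p)
eventually-∧ (M , P≥M) (N , Q≥N) = M ℕ.⊔ N , λ p p-prime M⊔N≤p →
  P≥M p p-prime (≤-trans (ℕ.m≤m⊔n M N) M⊔N≤p) , Q≥N p p-prime (≤-trans (ℕ.m≤n⊔m M N) M⊔N≤p)

eventually-mono : ∀ {P Q : ℕ → Set} → (∀ p → P p → Q p) → EventuallyPrimes P → EventuallyPrimes Q
eventually-mono P⇒Q (N , P≥N) = N , λ p p-prime N≤p → P⇒Q p (P≥N p p-prime N≤p)

eventually-All : ∀ {A : Set} {Q : A → ℕ → Set} (xs : List A) → (∀ x → EventuallyPrimes (Q x))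
  → EventuallyPrimes (λ p → All (λ x → Q x p) xs)
eventually-All []       Q = 0 , λ _ _ _ → []
eventually-All (x ∷ xs) Q = eventually-mono (λ _ (q , qs) → q ∷ qs) (eventually-∧ (Q x) (eventually-All xs Q))

m∣n! : ∀ {m n} .{{_ : NonZero m}} → m ≤ n → m ℕ.∣ n !
m∣n! {suc k} m≤n = ∣-trans (m∣m*n (k !)) (m≤n⇒m!∣n! m≤n)

-- Euclid: every prime factor of n! + 1 exceeds n.
∃prime> : ∀ n → ∃ λ p → Prime p × n < p
∃prime> n with factorise (suc (n !))
... | record { factors = [] ; isFactorisation = 1+n!≡1 } =
  ⊥-elim (ℕ.<⇒≢ (ℕ.1≤n! n) (sym (ℕ.suc-injective 1+n!≡1)))
... | record { factors = p ∷ ps ; isFactorisation = 1+n!≡p*ps ; factorsPrime = p-prime ∷ _ } =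
  p , p-prime , ℕ.≰⇒> p≰n
  where
  p∣n!+1 : p ℕ.∣ n ! ℕ.+ 1
  p∣n!+1 = subst (p ℕ.∣_) (trans (sym 1+n!≡p*ps) (ℕ.+-comm 1 (n !))) (m∣m*n _)
  p≰n : p ≰ n
  p≰n p≤n = ¬prime[1] (subst Prime (∣1⇒≡1 (∣m+n∣m⇒∣n p∣n!+1 (m∣n! {{prime⇒nonZero p-prime}} p≤n))) p-prime)

eventually⇒∃prime : ∀ {P : ℕ → Set} → EventuallyPrimes P → ∃ λ p → Prime p × P p
eventually⇒∃prime (N , P≥N) with ∃prime> N
... | p , p-prime , N<p = p , p-prime , P≥N p p-prime (ℕ.<⇒≤ N<p)

small-nonzero-∤ : ∀ {p z} → z ≢ + 0 → ∣ z ∣ < p → ¬ (+ p ∣ z)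
small-nonzero-∤ z≢0 ∣z∣<p = >⇒∤ {{ℕ.≢-nonZero (λ ∣z∣≡0 → z≢0 (∣i∣≡0⇒i≡0 ∣z∣≡0))}} ∣z∣<p

∣digit+x*e∣< : ∀ c x e {n} → ∣ c ∣ < ∣ x ∣ → ∣ e ∣ < ∣ x ∣ ^ n → ∣ c + x * e ∣ < ∣ x ∣ ^ suc n
∣digit+x*e∣< c x e {n} ∣c∣<∣x∣ ∣e∣<∣x∣^n = begin-strict
  ∣ c + x * e ∣           ≤⟨ ∣i+j∣≤∣i∣+∣j∣ c (x * e) ⟩
  ∣ c ∣ ℕ.+ ∣ x * e ∣     ≡⟨ cong (∣ c ∣ ℕ.+_) (abs-* x e) ⟩
  ∣ c ∣ ℕ.+ ∣ x ∣ ℕ.* ∣ e ∣ <⟨ ℕ.+-monoˡ-< _ ∣c∣<∣x∣ ⟩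
  ∣ x ∣ ℕ.+ ∣ x ∣ ℕ.* ∣ e ∣ ≡⟨ ℕ.*-suc ∣ x ∣ ∣ e ∣ ⟨
  ∣ x ∣ ℕ.* suc ∣ e ∣     ≤⟨ *-monoʳ-≤ ∣ x ∣ ∣e∣<∣x∣^n ⟩
  ∣ x ∣ ^ suc n           ∎
  where open ℕ.≤-Reasoning

-- |c + x e| = |x| |e| would be at least |x| unless e = 0.
digit+x*e≡0 : ∀ c x e → ∣ c ∣ < ∣ x ∣ → c + x * e ≡ + 0 → c ≡ + 0 × e ≡ + 0
digit+x*e≡0 c x e ∣c∣<∣x∣ c+xe≡0 = c≡0 , e≡0
  where
  c≡-xe : c ≡ - (x * e)
  c≡-xe = i-j≡0⇒i≡j c (- (x * e)) (trans (cong (λ t → c + t) (neg-involutive (x * e))) c+xe≡0)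
  ∣x∣*∣e∣<∣x∣*1 : ∣ x ∣ ℕ.* ∣ e ∣ < ∣ x ∣ ℕ.* 1
  ∣x∣*∣e∣<∣x∣*1 = subst₂ _<_ (trans (cong ∣_∣ c≡-xe) (trans (∣-i∣≡∣i∣ (x * e)) (abs-* x e)))
                            (sym (ℕ.*-identityʳ ∣ x ∣)) ∣c∣<∣x∣
  e≡0 : e ≡ + 0
  e≡0 = ∣i∣≡0⇒i≡0 (ℕ.n<1⇒n≡0 (*-cancelˡ-< ∣ x ∣ ∣ e ∣ 1 ∣x∣*∣e∣<∣x∣*1))
  c≡0 : c ≡ + 0
  c≡0 = trans (sym (trans (cong (λ t → c + x * t) e≡0) (trans (cong (λ t → c + t) (*-zeroʳ x)) (+-identityʳ c))))
              c+xe≡0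

∣eval1∣<∣x∣^length : ∀ cs x → All (λ c → ∣ c ∣ < ∣ x ∣) cs → ∣ eval1 cs x ∣ < ∣ x ∣ ^ length cs
∣eval1∣<∣x∣^length []       x []                 = s≤s z≤n
∣eval1∣<∣x∣^length (c ∷ cs) x (∣c∣<∣x∣ ∷ digits) =
  ∣digit+x*e∣< c x (eval1 cs x) {length cs} ∣c∣<∣x∣ (∣eval1∣<∣x∣^length cs x digits)

∣eval2∣<∣x∣^length : ∀ F x y → All (λ q → ∣ eval1 q y ∣ < ∣ x ∣) F → ∣ eval2 F x y ∣ < ∣ x ∣ ^ length F
∣eval2∣<∣x∣^length []       x y []                    = s≤s z≤n
∣eval2∣<∣x∣^length (q ∷ qs) x y (∣q[y]∣<∣x∣ ∷ digits) =
  ∣digit+x*e∣< (eval1 q y) x (eval2 qs x y) {length qs} ∣q[y]∣<∣x∣ (∣eval2∣<∣x∣^length qs x y digits)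

eval1≡0⇒zeros : ∀ cs x → All (λ c → ∣ c ∣ < ∣ x ∣) cs → eval1 cs x ≡ + 0 → All (_≡ + 0) cs
eval1≡0⇒zeros []       x []                 _  = []
eval1≡0⇒zeros (c ∷ cs) x (∣c∣<∣x∣ ∷ digits) eq with digit+x*e≡0 c x (eval1 cs x) ∣c∣<∣x∣ eq
... | c≡0 , cs[x]≡0 = c≡0 ∷ eval1≡0⇒zeros cs x digits cs[x]≡0

eval2≡0⇒zeros : ∀ F x y → All (All (λ c → ∣ c ∣ < ∣ y ∣)) F → All (λ q → ∣ eval1 q y ∣ < ∣ x ∣) F
  → eval2 F x y ≡ + 0 → All (All (_≡ + 0)) F
eval2≡0⇒zeros []       x y []                []                    _  = []
eval2≡0⇒zeros (q ∷ qs) x y (q-digits ∷ qss) (∣q[y]∣<∣x∣ ∷ digits) eq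
  with digit+x*e≡0 (eval1 q y) x (eval2 qs x y) ∣q[y]∣<∣x∣ eq
... | q[y]≡0 , qs[x,y]≡0 = eval1≡0⇒zeros q y q-digits q[y]≡0 ∷ eval2≡0⇒zeros qs x y qss digits qs[x,y]≡0

eval2≢0 : ∀ F x y → NonZeroPoly F → All (All (λ c → ∣ c ∣ < ∣ y ∣)) F
  → All (λ q → ∣ eval1 q y ∣ < ∣ x ∣) F → eval2 F x y ≢ + 0
eval2≢0 F x y F≢0 coeff-digits row-digits F[x,y]≡0
  with lookupAny (eval2≡0⇒zeros F x y coeff-digits row-digits F[x,y]≡0) F≢0
... | q≡0 , q≢0 with lookupAny q≡0 q≢0
...   | c≡0 , c≢0 = c≢0 c≡0

tendsToInfinity⇒∣∣> : ∀ {a} → TendsToInfinity a → ∀ n → EventuallyPrimes (λ p → n < ∣ a p ∣)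
tendsToInfinity⇒∣∣> a→∞ n = eventually-mono (λ _ → ≤∣∣) (a→∞ (suc n))
  where
  ≤∣∣ : ∀ {m z} → + m ℤ.≤ z → m ≤ ∣ z ∣
  ≤∣∣ (ℤ.+≤+ m≤n) = m≤n

littleO-pow⇒≤ : ∀ {f g : ℕ → ℕ} → (∀ d → d ≥ 1 → LittleO (λ p → f p ^ d) g)
  → EventuallyPrimes (λ p → 1 ≤ g p) → ∀ n → EventuallyPrimes (λ p → f p ^ n ≤ g p)
littleO-pow⇒≤ f^d=o[g] 1≤g 0       = 1≤g
littleO-pow⇒≤ {f} {g} f^d=o[g] 1≤g (suc d) =
  eventually-mono (λ p → subst (_≤ g p) (ℕ.*-identityˡ _)) (f^d=o[g] (suc d) (s≤s z≤n) 0)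

∣coeffs∣<∣b∣ : ∀ {b} → TendsToInfinity b → (cs : Poly1) → EventuallyPrimes (λ p → All (λ c → ∣ c ∣ < ∣ b p ∣) cs)
∣coeffs∣<∣b∣ b→∞ cs = eventually-All cs (λ c → tendsToInfinity⇒∣∣> b→∞ ∣ c ∣)

∣rows∣<∣a∣ : ∀ {a b} → TendsToInfinity a → TendsToInfinity b
  → (∀ d → d ≥ 1 → LittleO (λ p → ∣ b p ∣ ^ d) (λ p → ∣ a p ∣))
  → (F : Poly2) → EventuallyPrimes (λ p → All (λ q → ∣ eval1 q (b p) ∣ < ∣ a p ∣) F)
∣rows∣<∣a∣ {a} {b} a→∞ b→∞ b^d=o[a] F = eventually-All F λ q →
  eventually-mono (λ p (digits , ∣b∣^n≤∣a∣) → <-≤-trans (∣eval1∣<∣x∣^length q (b p) digits) ∣b∣^n≤∣a∣)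
    (eventually-∧ (∣coeffs∣<∣b∣ b→∞ q) (littleO-pow⇒≤ b^d=o[a] (tendsToInfinity⇒∣∣> a→∞ 0) (length q)))

lemma7p1 : (a b : Seq) → TendsToInfinity a → TendsToInfinity b
    → (∀ (d : ℕ) → d ≥ 1 → LittleO (λ p → ∣ a p ∣ ^ d) (λ p → p))
    → (∀ (d : ℕ) → d ≥ 1 → LittleO (λ p → ∣ b p ∣ ^ d) (λ p → ∣ a p ∣))
    → AlgIndep a b
lemma7p1 a b a→∞ b→∞ a^d=o[p] b^d=o[a] F F≢0 F[a,b]≈0
  with eventually⇒∃prime (eventually-∧
         (eventually-∧ (eventually-All F (∣coeffs∣<∣b∣ b→∞)) (∣rows∣<∣a∣ a→∞ b→∞ b^d=o[a] F))
         (eventually-∧ (littleO-pow⇒≤ a^d=o[p] (1 , λ _ _ 1≤p → 1≤p) (length F)) F[a,b]≈0))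
... | p , _ , ((coeffs< , rows<) , ∣a∣^n≤p , p∣F[a,b]-0) =
  small-nonzero-∤ (eval2≢0 F (a p) (b p) F≢0 coeffs< rows<)
    (<-≤-trans (∣eval2∣<∣x∣^length F (a p) (b p) rows<) ∣a∣^n≤p)
    (subst (λ z → + p ∣ z) (+-identityʳ (eval2 F (a p) (b p))) p∣F[a,b]-0)
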